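{- Let $G$ be a finite simple well-covered graph of girth at least five that belongs to the class $\mathcal{PC}$, and let $B$ be a basic $5$-cycle of $G$. If $B$ has a vertex $x$ which is adjacent to two vertices of $B$ that have degree two in $G$, then $x\in\mathrm{Shed}(G)$, i.e. $G\setminus x$ and $G\setminus N[x]$ are both vertex decomposable.
   Context: The girth of a graph is the number of vertices of a smallest induced cycle. A leaf is a vertex of degree one; a pendant edge is an edge incident to a leaf. An induced $5$-cycle of $G$ is basic if it contains no two adjacent vertices of degree at least three in $G$. A graph $G$ is in the class $\mathcal{PC}$ if $V(G)$ can be partitioned as $V=P\cup C$ where $P$ contains all vertices incident with pendant edges and the pendant edges form a perfect matching of $P$, and $C$ consists of the vertices of basic $5$-cycles which form a partition of $C$. For a graph $G=(V,E)$ and $x\in V$, $G\setminus x$ is the graph obtained by deleting $x$ and its incident edges; $N(x)$ is the set of neighbours of $x$, $N[x]=N(x)\cup\{x\}$, and $G\setminus N[x]$ is obtained by deleting all vertices of $N[x]$ and their incident edges. A graph is well-covered if all its maximal independent sets have the same cardinality. A graph $G$ is vertex decomposable if $G$ is well-covered and either (i) $G$ has no edges (possibly no vertices), or (ii) there is a vertex $x$ such that both $G\setminus x$ and $G\setminus N[x]$ are vertex decomposable. $\mathrm{Shed}(G)$ is the set of vertices $x$ such that $G\setminus x$ and $G\setminus N[x]$ are both vertex decomposable. -}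

module Defs where

open import Data.Nat using (ℕ; zero; suc; _≤_; _<_)
open import Data.Bool using (Bool; true; false)
open import Data.Fin using (Fin; toℕ)
open import Data.Fin.Subset using (Subset; _∈_; _∉_; _⊆_; ∁; _∩_; _-_; ∣_∣; ⊤; ⁅_⁆; _∪_)
open import Data.Vec using (tabulate)
open import Data.Product using (Σ; ∃; _×_; _,_)
open import Data.Sum using (_⊎_)
open import Relation.Binary.PropositionalEquality using (_≡_; _≢_)
open import Relation.Nullary using (¬_)
open import Function.Bundles using (_⇔_)

record Graph (n : ℕ) : Set where
  field
    E      : Fin n → Fin n → Bool
    sym    : ∀ u v → E u v ≡ E v u
    irrefl : ∀ u → E u u ≡ false
open Graph public

module _ {n : ℕ} (G : Graph n) where

  Adj : Fin n → Fin n → Set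
  Adj u v = E G u v ≡ true

  N : Fin n → Subset n
  N x = tabulate (E G x)

  N[_] : Fin n → Subset n
  N[ x ] = N x ∪ ⁅ x ⁆

  deg : Fin n → ℕ
  deg x = ∣ N x ∣

  -- Induced subgraphs of G are given by their vertex set S : Subset n.
  Independent : Subset n → Subset n → Set
  Independent S I = I ⊆ S × (∀ u v → u ∈ I → v ∈ I → ¬ Adj u v)

  MaximalIndependent : Subset n → Subset n → Set
  MaximalIndependent S I =
    Independent S I × (∀ v → v ∈ S → v ∉ I → Σ (Fin n) λ u → u ∈ I × Adj u v)

  WellCovered : Subset n → Set
  WellCovered S = ∀ I J → MaximalIndependent S I → MaximalIndependent S J → ∣ I ∣ ≡ ∣ J ∣

  NoEdges : Subset n → Set
  NoEdges S = ∀ u v → u ∈ S → v ∈ S → ¬ Adj u v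

  -- G[S] \ x  is  S - x ;   G[S] \ N[x]  is  S ∩ ∁ N[x]
  data VertexDecomposable (S : Subset n) : Set where
    vd-empty : WellCovered S → NoEdges S → VertexDecomposable S
    vd-shed  : WellCovered S → (x : Fin n) → x ∈ S →
               VertexDecomposable (S - x) →
               VertexDecomposable (S ∩ ∁ N[ x ]) →
               VertexDecomposable S

  Shed : Subset n → Fin n → Set
  Shed S x = VertexDecomposable (S - x) × VertexDecomposable (S ∩ ∁ N[ x ])

CycAdj : (k : ℕ) → Fin k → Fin k → Set
CycAdj k i j =
  toℕ j ≡ suc (toℕ i) ⊎ toℕ i ≡ suc (toℕ j)
  ⊎ (toℕ j ≡ 0 × suc (toℕ i) ≡ k) ⊎ (toℕ i ≡ 0 × suc (toℕ j) ≡ k)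

module _ {n : ℕ} (G : Graph n) where

  IsInducedCycle : (k : ℕ) → (Fin k → Fin n) → Set
  IsInducedCycle k f =
    3 ≤ k
    × (∀ i j → f i ≡ f j → i ≡ j)
    × (∀ i j → Adj G (f i) (f j) ⇔ CycAdj k i j)

  GirthAtLeast5 : Set
  GirthAtLeast5 = ∀ k f → IsInducedCycle k f → 5 ≤ k

  Basic5Cycle : (Fin 5 → Fin n) → Set
  Basic5Cycle B =
    IsInducedCycle 5 B ×
    (∀ i j → Adj G (B i) (B j) → deg G (B i) < 3 ⊎ deg G (B j) < 3)

  Pendant : Fin n → Fin n → Set
  Pendant u v = Adj G u v × (deg G u ≡ 1 ⊎ deg G v ≡ 1)

  -- class PC: V = P ⊎ C, P the vertices of the pendant edges, which form a
  -- perfect matching of P; C partitioned by the vertex sets of m basic 5-cycles.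
  InPC : Set
  InPC =
    Σ (Subset n) λ P → Σ ℕ λ m → Σ (Fin m → Fin 5 → Fin n) λ cyc →
      (∀ a → Basic5Cycle (cyc a))
      × (∀ a b i j → cyc a i ≡ cyc b j → a ≡ b)
      × (∀ a i → cyc a i ∉ P)
      × (∀ v → v ∉ P → Σ (Fin m) λ a → Σ (Fin 5) λ i → cyc a i ≡ v)
      × (∀ u v → Pendant u v → u ∈ P × v ∈ P)
      × (∀ u → u ∈ P → Σ (Fin n) λ v → Pendant u v × (∀ w → Pendant u w → w ≡ v))

-- We prove more: if G has girth ≥ 5, then every well-covered induced subgraph
-- G[S] in which each vertex is isolated, a leaf, adjacent to a leaf, or on a
-- pentagon that is basic in G[S] ("locally PC") is vertex decomposable, by
-- induction on |S|. Each edge of such a G[S] yields a shedding vertex x whose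
-- removal keeps both G[S] ∖ x and G[S] ∖ N[x] locally PC and well-covered:
-- either the neighbour of a leaf l (then l extends every independent set of
-- G[S] ∖ N[x]), or a pentagon vertex whose two pentagon neighbours have degree
-- ≤ 2 (then one of these does). Deleting x cuts each pentagon through x into
-- two pendant edges; deleting N[x] leaves pendant edges of each pentagon it
-- meets, because girth ≥ 5 stops N[x] from meeting a pentagon in more than a
-- vertex and its neighbours. The theorem is the second kind of shedder, in G.

module Submission where

open import Defs
open import Data.Nat using (ℕ; zero; suc; _<_; s≤s; z≤n)
import Data.Nat as ℕ
open import Data.Nat.Properties using (≤-refl; ≤-<-trans; <⇒≱; <-irrefl; n≤1+n; n<1+n; suc-injective)
open import Data.Nat.Induction using (<-wellFounded)
open import Data.Bool using (true; if_then_else_)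
open import Data.Bool.Properties using () renaming (_≟_ to _≟ᵇ_)
open import Data.Empty using (⊥; ⊥-elim)
open import Data.Fin using (Fin; zero; suc; toℕ; _≟_)
open import Data.Fin.Patterns using (0F; 1F; 2F; 3F; 4F)
open import Data.Fin.Properties using (any?)
open import Data.Fin.Subset using (Subset; _∈_; _∉_; _⊆_; ∁; _∩_; _∪_; _─_; _-_; ∣_∣; ⊤; ⁅_⁆; outside; inside)
open import Data.Fin.Subset.Properties
  using (_∈?_; ∈⊤; x∈⁅x⁆; x∈⁅y⁆⇒x≡y; x∈p∩q⁺; x∈p∩q⁻; x∈p∪q⁺; x∈p∪q⁻; x∉p⇒x∈∁p; x∈∁p⇒x∉p;
         ∪-identityʳ; p─q⊆p; x∈p∧x≢y⇒x∈p-y; x∈p⇒∣p-x∣<∣p∣; p⊆q⇒∣p∣≤∣q∣)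
open import Data.Product using (Σ; ∃; _×_; _,_; proj₁; proj₂)
open import Data.Sum using (_⊎_; inj₁; inj₂; [_,_])
import Data.Sum as Sum
open import Data.Vec using ([]; _∷_; lookup; here; there)
open import Data.Vec.Properties using (lookup∘tabulate; []=⇒lookup; lookup⇒[]=)
open import Function using (_∘_; _on_)
open import Function.Bundles using (_⇔_; mk⇔; Equivalence)
open import Induction.WellFounded using (Acc; acc)
import Relation.Binary.Construct.On as On
open import Relation.Binary.PropositionalEquality using (_≡_; _≢_; refl; trans; cong; subst; ≢-sym)
import Relation.Binary.PropositionalEquality as ≡
open ≡.≡-Reasoning
open import Relation.Nullary using (¬_; Dec; yes; no; does)
open import Relation.Nullary.Decidable using (_×-dec_; _⊎-dec_; from-no)

x∈p─q⇒x∉q : ∀ {n} (p q : Subset n) {x} → x ∈ p ─ q → x ∉ q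
x∈p─q⇒x∉q (_ ∷ p) (_ ∷ q) {suc x} (there x∈p─q) (there x∈q) = x∈p─q⇒x∉q p q x∈p─q x∈q
x∈p─q⇒x∉q (_ ∷ p) (inside ∷ q) {zero} () here

x∈p-y⇒x∈p : ∀ {n} (p : Subset n) {x y} → x ∈ p - y → x ∈ p
x∈p-y⇒x∈p p {y = y} = p─q⊆p p ⁅ y ⁆

x∈p-y⇒x≢y : ∀ {n} (p : Subset n) {x y} → x ∈ p - y → x ≢ y
x∈p-y⇒x≢y p {x} x∈p-x refl = x∈p─q⇒x∉q p ⁅ x ⁆ x∈p-x (x∈⁅x⁆ x)

∣p∪⁅x⁆∣≡1+∣p∣ : ∀ {n} (p : Subset n) {x} → x ∉ p → ∣ p ∪ ⁅ x ⁆ ∣ ≡ suc ∣ p ∣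
∣p∪⁅x⁆∣≡1+∣p∣ (outside ∷ p) {zero}  _   = cong (suc ∘ ∣_∣) (∪-identityʳ p)
∣p∪⁅x⁆∣≡1+∣p∣ (inside  ∷ p) {zero}  x∉p = ⊥-elim (x∉p here)
∣p∪⁅x⁆∣≡1+∣p∣ (outside ∷ p) {suc x} x∉p = ∣p∪⁅x⁆∣≡1+∣p∣ p (x∉p ∘ there)
∣p∪⁅x⁆∣≡1+∣p∣ (inside  ∷ p) {suc x} x∉p = cong suc (∣p∪⁅x⁆∣≡1+∣p∣ p (x∉p ∘ there))

x∈p⇒0<∣p∣ : ∀ {n} {p : Subset n} {x} → x ∈ p → 0 < ∣ p ∣
x∈p⇒0<∣p∣ x∈p = ≤-<-trans z≤n (x∈p⇒∣p-x∣<∣p∣ x∈p)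

two-elements⇒1<∣p∣ : ∀ {n} {p : Subset n} {a b} → a ∈ p → b ∈ p → a ≢ b → 1 < ∣ p ∣
two-elements⇒1<∣p∣ a∈p b∈p a≢b =
  ≤-<-trans (x∈p⇒0<∣p∣ (x∈p∧x≢y⇒x∈p-y b∈p (≢-sym a≢b))) (x∈p⇒∣p-x∣<∣p∣ a∈p)

three-elements⇒2<∣p∣ : ∀ {n} {p : Subset n} {a b c} → a ∈ p → b ∈ p → c ∈ p →
                       a ≢ b → a ≢ c → b ≢ c → 2 < ∣ p ∣
three-elements⇒2<∣p∣ a∈p b∈p c∈p a≢b a≢c b≢c =
  ≤-<-trans (two-elements⇒1<∣p∣ (x∈p∧x≢y⇒x∈p-y b∈p (≢-sym a≢b)) (x∈p∧x≢y⇒x∈p-y c∈p (≢-sym a≢c)) b≢c)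
            (x∈p⇒∣p-x∣<∣p∣ a∈p)

cycAdj? : ∀ k (i j : Fin k) → Dec (CycAdj k i j)
cycAdj? k i j =
  toℕ j ℕ.≟ suc (toℕ i) ⊎-dec toℕ i ℕ.≟ suc (toℕ j)
  ⊎-dec (toℕ j ℕ.≟ 0 ×-dec suc (toℕ i) ℕ.≟ k) ⊎-dec (toℕ i ℕ.≟ 0 ×-dec suc (toℕ j) ℕ.≟ k)

decided⇒⇔ : ∀ {A P : Set} (P? : Dec P) → (if does P? then A else ¬ A) → A ⇔ P
decided⇒⇔ (yes p) a  = mk⇔ (λ _ → p) (λ _ → a)
decided⇒⇔ (no ¬p) ¬a = mk⇔ (⊥-elim ∘ ¬a) (⊥-elim ∘ ¬p)

next : Fin 5 → Fin 5
next 0F = 1F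
next 1F = 2F
next 2F = 3F
next 3F = 4F
next 4F = 0F

cover-pair : ∀ {A : Set} {Q : A → Set} {a b p q : A} →
             a ≡ p ⊎ a ≡ q → b ≡ p ⊎ b ≡ q → a ≢ b → Q a → Q b → Q p × Q q
cover-pair (inj₁ refl) (inj₂ refl) _   Qa Qb = Qa , Qb
cover-pair (inj₂ refl) (inj₁ refl) _   Qa Qb = Qb , Qa
cover-pair (inj₁ refl) (inj₁ refl) a≢b _  _  = ⊥-elim (a≢b refl)
cover-pair (inj₂ refl) (inj₂ refl) a≢b _  _  = ⊥-elim (a≢b refl)

module Shedding {n : ℕ} (G : Graph n) where

  adj-sym : ∀ {u v} → Adj G u v → Adj G v u
  adj-sym {u} {v} uv = trans (Graph.sym G v u) uv

  ¬adj-refl : ∀ u → ¬ Adj G u u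
  ¬adj-refl u uu with trans (≡.sym uu) (irrefl G u)
  ... | ()

  adj⇒≢ : ∀ {u v} → Adj G u v → u ≢ v
  adj⇒≢ uv refl = ¬adj-refl _ uv

  Adj? : ∀ u v → Dec (Adj G u v)
  Adj? u v = E G u v ≟ᵇ true

  ∈N⁺ : ∀ {v w} → Adj G v w → w ∈ N G v
  ∈N⁺ {v} {w} vw = lookup⇒[]= w _ (trans (lookup∘tabulate (E G v) w) vw)

  ∈N⁻ : ∀ {v w} → w ∈ N G v → Adj G v w
  ∈N⁻ {v} {w} w∈Nv = trans (≡.sym (lookup∘tabulate (E G v) w)) ([]=⇒lookup w∈Nv)

  infixl 6 _∖N[_]
  _∖N[_] : Subset n → Fin n → Subset n
  S ∖N[ x ] = S ∩ ∁ (N[_] G x)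

  ∈∖N[]⁺ : ∀ {S x v} → v ∈ S → ¬ Adj G x v → v ≢ x → v ∈ S ∖N[ x ]
  ∈∖N[]⁺ {x = x} {v} v∈S ¬xv v≢x = x∈p∩q⁺ (v∈S , x∉p⇒x∈∁p v∉N[x])
    where
    v∉N[x] : v ∉ N[_] G x
    v∉N[x] v∈N[x] = [ ¬xv ∘ ∈N⁻ , v≢x ∘ x∈⁅y⁆⇒x≡y x ] (x∈p∪q⁻ (N G x) ⁅ x ⁆ v∈N[x])

  ∈∖N[]⇒∈ : ∀ {S x v} → v ∈ S ∖N[ x ] → v ∈ S
  ∈∖N[]⇒∈ {S} v∈ = proj₁ (x∈p∩q⁻ S _ v∈)

  ∈∖N[]⇒¬adj : ∀ {S x v} → v ∈ S ∖N[ x ] → ¬ Adj G x v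
  ∈∖N[]⇒¬adj {S} v∈ xv = x∈∁p⇒x∉p (proj₂ (x∈p∩q⁻ S _ v∈)) (x∈p∪q⁺ (inj₁ (∈N⁺ xv)))

  ∈∖N[]⇒≢ : ∀ {S x v} → v ∈ S ∖N[ x ] → v ≢ x
  ∈∖N[]⇒≢ {S} {x} v∈ refl = x∈∁p⇒x∉p (proj₂ (x∈p∩q⁻ S _ v∈)) (x∈p∪q⁺ (inj₂ (x∈⁅x⁆ x)))

  ∣∖N[]∣<∣p∣ : ∀ {S x} → x ∈ S → ∣ S ∖N[ x ] ∣ < ∣ S ∣
  ∣∖N[]∣<∣p∣ {S} {x} x∈S = ≤-<-trans (p⊆q⇒∣p∣≤∣q∣ {p = S ∖N[ x ]} {q = S - x} ∖N[]⊆-) (x∈p⇒∣p-x∣<∣p∣ x∈S)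
    where
    ∖N[]⊆- : S ∖N[ x ] ⊆ S - x
    ∖N[]⊆- v∈ = x∈p∧x≢y⇒x∈p-y (∈∖N[]⇒∈ v∈) (∈∖N[]⇒≢ v∈)

  -- For concrete i and j this computes to the required (non-)adjacency, so the
  -- adjacency table of a small cycle is given clause by clause.
  CycleEntry : ∀ {k} → (Fin k → Fin n) → Fin k → Fin k → Set
  CycleEntry {k} f i j = if does (cycAdj? k i j) then Adj G (f i) (f j) else ¬ Adj G (f i) (f j)

  girth-excludes : GirthAtLeast5 G → ∀ {k} (f : Fin k → Fin n) → k < 5 → ¬ IsInducedCycle G k f
  girth-excludes girth f k<5 cycle = <⇒≱ k<5 (girth _ f cycle)

  no-triangle : GirthAtLeast5 G → ∀ {a b c} → Adj G a b → Adj G b c → Adj G c a → ⊥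
  no-triangle girth {a} {b} {c} ab bc ca =
    girth-excludes girth f (s≤s (s≤s (s≤s (s≤s z≤n))))
      (≤-refl , injective , λ i j → decided⇒⇔ (cycAdj? _ i j) (entry i j))
    where
    f : Fin 3 → Fin n
    f = lookup (a ∷ b ∷ c ∷ [])
    injective : ∀ i j → f i ≡ f j → i ≡ j
    injective 0F 0F _ = refl
    injective 0F 1F e = ⊥-elim (adj⇒≢ ab e)
    injective 0F 2F e = ⊥-elim (adj⇒≢ ca (≡.sym e))
    injective 1F 0F e = ⊥-elim (adj⇒≢ ab (≡.sym e))
    injective 1F 1F _ = refl
    injective 1F 2F e = ⊥-elim (adj⇒≢ bc e)
    injective 2F 0F e = ⊥-elim (adj⇒≢ ca e)
    injective 2F 1F e = ⊥-elim (adj⇒≢ bc (≡.sym e))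
    injective 2F 2F _ = refl
    entry : ∀ i j → CycleEntry f i j
    entry 0F 0F = ¬adj-refl a
    entry 0F 1F = ab
    entry 0F 2F = adj-sym ca
    entry 1F 0F = adj-sym ab
    entry 1F 1F = ¬adj-refl b
    entry 1F 2F = bc
    entry 2F 0F = ca
    entry 2F 1F = adj-sym bc
    entry 2F 2F = ¬adj-refl c

  no-square : GirthAtLeast5 G → ∀ {a b c d} → Adj G a b → Adj G b c → Adj G c d → Adj G d a →
              a ≢ c → b ≢ d → ⊥
  no-square girth {a} {b} {c} {d} ab bc cd da a≢c b≢d =
    girth-excludes girth f ≤-refl (n≤1+n 3 , injective , λ i j → decided⇒⇔ (cycAdj? _ i j) (entry i j))
    where
    ¬ac : ¬ Adj G a c
    ¬ac ac = no-triangle girth ab bc (adj-sym ac)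
    ¬bd : ¬ Adj G b d
    ¬bd bd = no-triangle girth bc cd (adj-sym bd)
    f : Fin 4 → Fin n
    f = lookup (a ∷ b ∷ c ∷ d ∷ [])
    injective : ∀ i j → f i ≡ f j → i ≡ j
    injective 0F 0F _ = refl
    injective 0F 1F e = ⊥-elim (adj⇒≢ ab e)
    injective 0F 2F e = ⊥-elim (a≢c e)
    injective 0F 3F e = ⊥-elim (adj⇒≢ da (≡.sym e))
    injective 1F 0F e = ⊥-elim (adj⇒≢ ab (≡.sym e))
    injective 1F 1F _ = refl
    injective 1F 2F e = ⊥-elim (adj⇒≢ bc e)
    injective 1F 3F e = ⊥-elim (b≢d e)
    injective 2F 0F e = ⊥-elim (a≢c (≡.sym e))
    injective 2F 1F e = ⊥-elim (adj⇒≢ bc (≡.sym e))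
    injective 2F 2F _ = refl
    injective 2F 3F e = ⊥-elim (adj⇒≢ cd e)
    injective 3F 0F e = ⊥-elim (adj⇒≢ da e)
    injective 3F 1F e = ⊥-elim (b≢d (≡.sym e))
    injective 3F 2F e = ⊥-elim (adj⇒≢ cd (≡.sym e))
    injective 3F 3F _ = refl
    entry : ∀ i j → CycleEntry f i j
    entry 0F 0F = ¬adj-refl a
    entry 0F 1F = ab
    entry 0F 2F = ¬ac
    entry 0F 3F = adj-sym da
    entry 1F 0F = adj-sym ab
    entry 1F 1F = ¬adj-refl b
    entry 1F 2F = bc
    entry 1F 3F = ¬bd
    entry 2F 0F = ¬ac ∘ adj-sym
    entry 2F 1F = adj-sym bc
    entry 2F 2F = ¬adj-refl c
    entry 2F 3F = cd
    entry 3F 0F = da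
    entry 3F 1F = ¬bd ∘ adj-sym
    entry 3F 2F = adj-sym cd
    entry 3F 3F = ¬adj-refl d

  Deg≤2 : Subset n → Fin n → Set
  Deg≤2 S v = ∀ {a b} → a ∈ S → b ∈ S → Adj G v a → Adj G v b → a ≢ b →
              ∀ w → w ∈ S → Adj G v w → w ≡ a ⊎ w ≡ b

  deg≤2-mono : ∀ {S S′ v} → S′ ⊆ S → Deg≤2 S v → Deg≤2 S′ v
  deg≤2-mono S′⊆S low a∈ b∈ va vb a≢b w w∈ = low (S′⊆S a∈) (S′⊆S b∈) va vb a≢b w (S′⊆S w∈)

  deg<3⇒deg≤2 : ∀ {v} → deg G v < 3 → Deg≤2 ⊤ v
  deg<3⇒deg≤2 deg<3 {a} {b} _ _ va vb a≢b w _ vw with w ≟ a | w ≟ b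
  ... | yes w≡a | _       = inj₁ w≡a
  ... | no _    | yes w≡b = inj₂ w≡b
  ... | no w≢a  | no w≢b  =
    ⊥-elim (<⇒≱ deg<3 (three-elements⇒2<∣p∣ (∈N⁺ va) (∈N⁺ vb) (∈N⁺ vw) a≢b (≢-sym w≢a) (≢-sym w≢b)))

  OnlyNeighbour : Subset n → Fin n → Fin n → Set
  OnlyNeighbour S v u = u ∈ S × Adj G v u × (∀ w → w ∈ S → Adj G v w → w ≡ u)

  onlyNeighbour-mono : ∀ {S S′ v u} → S′ ⊆ S → u ∈ S′ → OnlyNeighbour S v u → OnlyNeighbour S′ v u
  onlyNeighbour-mono S′⊆S u∈S′ (_ , vu , only) = u∈S′ , vu , λ w → only w ∘ S′⊆S

  onlyNeighbour-removed : ∀ {S S′ v u} → S′ ⊆ S → u ∉ S′ → OnlyNeighbour S v u →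
                          ∀ w → w ∈ S′ → ¬ Adj G v w
  onlyNeighbour-removed S′⊆S u∉S′ (_ , _ , only) w w∈S′ vw =
    u∉S′ (subst (_∈ _) (only w (S′⊆S w∈S′) vw) w∈S′)

  deg≤2⇒onlyNeighbour : ∀ {S S′ v a b} → Deg≤2 S v → S′ ⊆ S → a ∈ S′ → b ∈ S →
                        Adj G v a → Adj G v b → a ≢ b → b ∉ S′ → OnlyNeighbour S′ v a
  deg≤2⇒onlyNeighbour {S′ = S′} {v} {a} low S′⊆S a∈S′ b∈S va vb a≢b b∉S′ = a∈S′ , va , only
    where
    only : ∀ w → w ∈ S′ → Adj G v w → w ≡ a
    only w w∈S′ vw with low (S′⊆S a∈S′) b∈S va vb a≢b w (S′⊆S w∈S′) vw
    ... | inj₁ w≡a  = w≡a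
    ... | inj₂ refl = ⊥-elim (b∉S′ w∈S′)

  deg≡1⇒onlyNeighbour : ∀ {v u} → deg G v ≡ 1 → Adj G v u → OnlyNeighbour ⊤ v u
  deg≡1⇒onlyNeighbour {v} {u} deg≡1 vu = ∈⊤ , vu , only
    where
    only : ∀ w → w ∈ ⊤ → Adj G v w → w ≡ u
    only w _ vw with w ≟ u
    ... | yes w≡u = w≡u
    ... | no w≢u  = ⊥-elim (<-irrefl (≡.sym deg≡1) (two-elements⇒1<∣p∣ (∈N⁺ vw) (∈N⁺ vu) w≢u))

  record Pentagon : Set where
    field
      vertex    : Fin 5 → Fin n
      edge      : ∀ i → Adj G (vertex i) (vertex (next i))
      chordless : ∀ i → ¬ Adj G (vertex i) (vertex (next (next i)))
  open Pentagon public

  rotate : Pentagon → Pentagon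
  rotate C = record { vertex = vertex C ∘ next ; edge = edge C ∘ next ; chordless = chordless C ∘ next }

  rotateBy : ℕ → Pentagon → Pentagon
  rotateBy zero    C = C
  rotateBy (suc k) C = rotateBy k (rotate C)

  rotateTo : Fin 5 → Pentagon → Pentagon
  rotateTo p = rotateBy (toℕ p)

  vertex-rotateTo : ∀ p C → vertex (rotateTo p C) 0F ≡ vertex C p
  vertex-rotateTo 0F C = refl
  vertex-rotateTo 1F C = refl
  vertex-rotateTo 2F C = refl
  vertex-rotateTo 3F C = refl
  vertex-rotateTo 4F C = refl

  v₀≢v₂ : ∀ C → vertex C 0F ≢ vertex C 2F
  v₀≢v₂ C v₀≡v₂ = chordless C 2F (adj-sym (subst (Adj G (vertex C 4F)) v₀≡v₂ (edge C 4F)))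

  v₁≢v₄ : ∀ C → vertex C 1F ≢ vertex C 4F
  v₁≢v₄ C = ≢-sym (v₀≢v₂ (rotateBy 4 C))

  v₃≢v₀ : ∀ C → vertex C 3F ≢ vertex C 0F
  v₃≢v₀ C = v₀≢v₂ (rotateBy 3 C)

  AllVertices : (Fin n → Set) → Pentagon → Set
  AllVertices P C = ∀ i → P (vertex C i)

  allVertices-rotate⁻ : ∀ {P} C → AllVertices P (rotate C) → AllVertices P C
  allVertices-rotate⁻ C all 0F = all 4F
  allVertices-rotate⁻ C all 1F = all 0F
  allVertices-rotate⁻ C all 2F = all 1F
  allVertices-rotate⁻ C all 3F = all 2F
  allVertices-rotate⁻ C all 4F = all 3F

  allVertices-rotateBy⁺ : ∀ {P} k C → AllVertices P C → AllVertices P (rotateBy k C)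
  allVertices-rotateBy⁺ zero    C all = all
  allVertices-rotateBy⁺ {P} (suc k) C all = allVertices-rotateBy⁺ {P} k (rotate C) (all ∘ next)

  allVertices-rotateBy⁻ : ∀ {P} k C → AllVertices P (rotateBy k C) → AllVertices P C
  allVertices-rotateBy⁻ zero    C all = all
  allVertices-rotateBy⁻ {P} (suc k) C all =
    allVertices-rotate⁻ {P} C (allVertices-rotateBy⁻ {P} k (rotate C) all)

  neighbours-of-v₀ : ∀ C → AllVertices (λ u → Adj G (vertex C 0F) u → u ≡ vertex C 1F ⊎ u ≡ vertex C 4F) C
  neighbours-of-v₀ C 0F v₀v₀ = ⊥-elim (¬adj-refl _ v₀v₀)
  neighbours-of-v₀ C 1F _    = inj₁ refl
  neighbours-of-v₀ C 2F v₀v₂ = ⊥-elim (chordless C 0F v₀v₂)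
  neighbours-of-v₀ C 3F v₀v₃ = ⊥-elim (chordless C 3F (adj-sym v₀v₃))
  neighbours-of-v₀ C 4F _    = inj₂ refl

  -- The paper's "basic", with degrees taken in G[S].
  BasicIn : Subset n → Pentagon → Set
  BasicIn S C = ∀ i → Deg≤2 S (vertex C i) ⊎ Deg≤2 S (vertex C (next i))

  basicIn-mono : ∀ {S S′} → S′ ⊆ S → ∀ {C} → BasicIn S C → BasicIn S′ C
  basicIn-mono S′⊆S basic = Sum.map (deg≤2-mono S′⊆S) (deg≤2-mono S′⊆S) ∘ basic

  basicIn-rotateBy : ∀ {S} k C → BasicIn S C → BasicIn S (rotateBy k C)
  basicIn-rotateBy zero    C basic = basic
  basicIn-rotateBy (suc k) C basic = basicIn-rotateBy k (rotate C) (basic ∘ next)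

  basicIn-neighbours₀ : ∀ {S} C → BasicIn S C →
    (Deg≤2 S (vertex C 0F) → Deg≤2 S (vertex C 1F) × Deg≤2 S (vertex C 4F)) →
    Deg≤2 S (vertex C 1F) × Deg≤2 S (vertex C 4F)
  basicIn-neighbours₀ C basic from-v₀ with basic 0F | basic 4F
  ... | inj₂ low₁ | inj₁ low₄ = low₁ , low₄
  ... | inj₁ low₀ | _         = from-v₀ low₀
  ... | inj₂ _    | inj₂ low₀ = from-v₀ low₀

  basicIn⇒sheddable-position : ∀ {S} C → BasicIn S C →
    Σ (Fin 5) λ p → Deg≤2 S (vertex (rotateTo p C) 1F) × Deg≤2 S (vertex (rotateTo p C) 4F)
  basicIn⇒sheddable-position C basic with basic 0F | basic 2F | basic 3F
  ... | inj₁ low₀ | inj₁ low₂ | _         = 1F , low₂ , low₀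
  ... | inj₁ low₀ | inj₂ low₃ | _         = 4F , low₀ , low₃
  ... | inj₂ low₁ | _         | inj₁ low₃ = 2F , low₃ , low₁
  ... | inj₂ low₁ | _         | inj₂ low₄ = 0F , low₁ , low₄

  ¬deg≤2-v₀ : ∀ {S w} C → AllVertices (_∈ S) C → w ∈ S → Adj G (vertex C 0F) w →
              w ≢ vertex C 1F → w ≢ vertex C 4F → ¬ Deg≤2 S (vertex C 0F)
  ¬deg≤2-v₀ C inS w∈S v₀w w≢v₁ w≢v₄ low₀ =
    [ w≢v₁ , w≢v₄ ] (low₀ (inS 1F) (inS 4F) (edge C 0F) (adj-sym (edge C 4F)) (v₁≢v₄ C) _ w∈S v₀w)

  -- The class PC relaxed so that it is inherited by the induced subgraphs met in
  -- the induction: no partition is required, only a role for every vertex.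
  data Role (S : Subset n) (v : Fin n) : Set where
    isolated : (∀ w → w ∈ S → ¬ Adj G v w) → Role S v
    leaf     : ∀ u → OnlyNeighbour S v u → Role S v
    support  : ∀ l → l ∈ S → OnlyNeighbour S l v → Role S v
    onBasic  : ∀ C i → vertex C i ≡ v → AllVertices (_∈ S) C → BasicIn S C → Role S v

  HasRole : Subset n → Fin n → Set
  HasRole S v = v ∈ S → Role S v

  LocallyPC : Subset n → Set
  LocallyPC S = ∀ v → HasRole S v

  wlog-vertex₀ : ∀ {S} {P R T : Fin n → Set} →
    (∀ C → AllVertices T C → BasicIn S C → R (vertex C 0F) → AllVertices P C) →
    ∀ C p → AllVertices T C → BasicIn S C → R (vertex C p) → AllVertices P C
  wlog-vertex₀ {P = P} {R} {T} claim C p all basic r =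
    allVertices-rotateBy⁻ {P} (toℕ p) C
      (claim (rotateTo p C) (allVertices-rotateBy⁺ {T} (toℕ p) C all) (basicIn-rotateBy (toℕ p) C basic)
             (subst R (≡.sym (vertex-rotateTo p C)) r))

  roles-intact : ∀ {S} C → AllVertices (_∈ S) C → BasicIn S C → AllVertices (HasRole S) C
  roles-intact C inS basic i _ = onBasic C i refl inS basic

  roles-without-v₀ : ∀ {S S′} C → S′ ⊆ S → AllVertices (_∈ S) C →
    vertex C 0F ∉ S′ → vertex C 1F ∈ S′ → vertex C 2F ∈ S′ → vertex C 3F ∈ S′ → vertex C 4F ∈ S′ →
    Deg≤2 S (vertex C 1F) → Deg≤2 S (vertex C 4F) → AllVertices (HasRole S′) C
  roles-without-v₀ {S′ = S′} C S′⊆S inS v₀∉ v₁∈ v₂∈ v₃∈ v₄∈ low₁ low₄ = λ where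
      0F v₀∈ → ⊥-elim (v₀∉ v₀∈)
      1F _   → leaf _ only₁
      2F _   → support _ v₁∈ only₁
      3F _   → support _ v₄∈ only₄
      4F _   → leaf _ only₄
    where
    only₁ : OnlyNeighbour S′ (vertex C 1F) (vertex C 2F)
    only₁ = deg≤2⇒onlyNeighbour low₁ S′⊆S v₂∈ (inS 0F) (edge C 1F) (adj-sym (edge C 0F))
                                 (≢-sym (v₀≢v₂ C)) v₀∉
    only₄ : OnlyNeighbour S′ (vertex C 4F) (vertex C 3F)
    only₄ = deg≤2⇒onlyNeighbour low₄ S′⊆S v₃∈ (inS 0F) (adj-sym (edge C 3F)) (edge C 4F) (v₃≢v₀ C) v₀∉

  roles-without-v₄v₀v₁ : ∀ {S S′} C → S′ ⊆ S → AllVertices (_∈ S) C → BasicIn S C →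
    vertex C 0F ∉ S′ → vertex C 1F ∉ S′ → vertex C 2F ∈ S′ → vertex C 3F ∈ S′ → vertex C 4F ∉ S′ →
    AllVertices (HasRole S′) C
  roles-without-v₄v₀v₁ {S} {S′} C S′⊆S inS basic v₀∉ v₁∉ v₂∈ v₃∈ v₄∉ = λ where
      0F v₀∈ → ⊥-elim (v₀∉ v₀∈)
      1F v₁∈ → ⊥-elim (v₁∉ v₁∈)
      2F _   → [ leaf _ , support _ v₃∈ ] pendant
      3F _   → [ support _ v₂∈ , leaf _ ] pendant
      4F v₄∈ → ⊥-elim (v₄∉ v₄∈)
    where
    pendant : OnlyNeighbour S′ (vertex C 2F) (vertex C 3F) ⊎ OnlyNeighbour S′ (vertex C 3F) (vertex C 2F)
    pendant = Sum.map leaf₂ leaf₃ (basic 2F)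
      where
      leaf₂ : Deg≤2 S (vertex C 2F) → OnlyNeighbour S′ (vertex C 2F) (vertex C 3F)
      leaf₂ low₂ = deg≤2⇒onlyNeighbour low₂ S′⊆S v₃∈ (inS 1F) (edge C 2F) (adj-sym (edge C 1F))
                                       (≢-sym (v₀≢v₂ (rotate C))) v₁∉
      leaf₃ : Deg≤2 S (vertex C 3F) → OnlyNeighbour S′ (vertex C 3F) (vertex C 2F)
      leaf₃ low₃ = deg≤2⇒onlyNeighbour low₃ S′⊆S v₂∈ (inS 4F) (adj-sym (edge C 2F)) (edge C 3F)
                                       (v₀≢v₂ (rotateBy 2 C)) v₄∉

  CycleNeighboursDeg≤2 : Subset n → Fin n → Set
  CycleNeighboursDeg≤2 S x = ∀ C → AllVertices (_∈ S) C → BasicIn S C → vertex C 0F ≡ x →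
                             Deg≤2 S (vertex C 1F) × Deg≤2 S (vertex C 4F)

  LeafOnlyInK₂ : Subset n → Fin n → Set
  LeafOnlyInK₂ S x = ∀ v → OnlyNeighbour S x v → OnlyNeighbour S v x

  roles-minus : ∀ {S x} → CycleNeighboursDeg≤2 S x →
                ∀ C → AllVertices (_∈ S) C → BasicIn S C → AllVertices (HasRole (S - x)) C
  roles-minus {S} {x} around C inS basic with any? (λ p → vertex C p ≟ x)
  ... | yes (p , vₚ≡x) =
    wlog-vertex₀ {P = HasRole (S - x)} {R = _≡ x} {T = _∈ S} at-v₀ C p inS basic vₚ≡x
    where
    at-v₀ : ∀ C → AllVertices (_∈ S) C → BasicIn S C → vertex C 0F ≡ x → AllVertices (HasRole (S - x)) C
    at-v₀ C inS basic v₀≡x =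
      roles-without-v₀ C (x∈p-y⇒x∈p S) inS (λ v₀∈ → x∈p-y⇒x≢y S v₀∈ v₀≡x)
        (keep 1F (≢-sym (adj⇒≢ (edge C 0F)))) (keep 2F (≢-sym (v₀≢v₂ C)))
        (keep 3F (v₃≢v₀ C)) (keep 4F (adj⇒≢ (edge C 4F)))
        (proj₁ (around C inS basic v₀≡x)) (proj₂ (around C inS basic v₀≡x))
      where
      keep : ∀ i → vertex C i ≢ vertex C 0F → vertex C i ∈ S - x
      keep i vᵢ≢v₀ = x∈p∧x≢y⇒x∈p-y (inS i) (λ vᵢ≡x → vᵢ≢v₀ (trans vᵢ≡x (≡.sym v₀≡x)))
  ... | no off = roles-intact C (λ i → x∈p∧x≢y⇒x∈p-y (inS i) (λ vᵢ≡x → off (i , vᵢ≡x)))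
                                (basicIn-mono (x∈p-y⇒x∈p S) {C} basic)

  locallyPC-minus : ∀ {S x} → LocallyPC S → CycleNeighboursDeg≤2 S x → LeafOnlyInK₂ S x →
                    LocallyPC (S - x)
  locallyPC-minus {S} {x} pc around k₂ v v∈S-x with pc v (x∈p-y⇒x∈p S v∈S-x)
  ... | isolated none = isolated (λ w → none w ∘ x∈p-y⇒x∈p S)
  ... | leaf u only with u ≟ x
  ...   | yes refl = isolated (onlyNeighbour-removed (x∈p-y⇒x∈p S) (λ x∈ → x∈p-y⇒x≢y S x∈ refl) only)
  ...   | no u≢x   = leaf u (onlyNeighbour-mono (x∈p-y⇒x∈p S) (x∈p∧x≢y⇒x∈p-y (proj₁ only) u≢x) only)
  locallyPC-minus {S} {x} pc around k₂ v v∈S-x | support l l∈S only with l ≟ x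
  ...   | yes refl = isolated (onlyNeighbour-removed (x∈p-y⇒x∈p S) (λ x∈ → x∈p-y⇒x≢y S x∈ refl) (k₂ v only))
  ...   | no l≢x   = support l (x∈p∧x≢y⇒x∈p-y l∈S l≢x) (onlyNeighbour-mono (x∈p-y⇒x∈p S) v∈S-x only)
  locallyPC-minus {S} {x} pc around k₂ v v∈S-x | onBasic C i vᵢ≡v inS basic =
    subst (HasRole (S - x)) vᵢ≡v (roles-minus around C inS basic i) v∈S-x

  roles-∖N[]-on : ∀ {S x} → ∀ C → AllVertices (_∈ S) C → BasicIn S C → vertex C 0F ≡ x →
                  AllVertices (HasRole (S ∖N[ x ])) C
  roles-∖N[]-on {S} {x} C inS basic refl =
    roles-without-v₄v₀v₁ C ∈∖N[]⇒∈ inS basic (λ v₀∈ → ∈∖N[]⇒≢ v₀∈ refl)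
      (λ v₁∈ → ∈∖N[]⇒¬adj v₁∈ (edge C 0F))
      (∈∖N[]⁺ (inS 2F) (chordless C 0F) (≢-sym (v₀≢v₂ C)))
      (∈∖N[]⁺ (inS 3F) (chordless C 3F ∘ adj-sym) (v₃≢v₀ C))
      (λ v₄∈ → ∈∖N[]⇒¬adj v₄∈ (adj-sym (edge C 4F)))

  -- Girth ≥ 5 keeps a vertex adjacent to v₀ away from the rest of the pentagon.
  roles-∖N[]-beside : GirthAtLeast5 G → ∀ {S x} → x ∈ S →
    ∀ C → AllVertices (λ u → u ∈ S × u ≢ x) C → BasicIn S C → Adj G x (vertex C 0F) →
    AllVertices (HasRole (S ∖N[ x ])) C
  roles-∖N[]-beside girth {S} {x} x∈S C onC basic xv₀ =
    roles-without-v₀ C ∈∖N[]⇒∈ inS (λ v₀∈ → ∈∖N[]⇒¬adj v₀∈ xv₀)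
      (∈∖N[]⁺ (inS 1F) ¬xv₁ (proj₂ (onC 1F))) (∈∖N[]⁺ (inS 2F) ¬xv₂ (proj₂ (onC 2F)))
      (∈∖N[]⁺ (inS 3F) ¬xv₃ (proj₂ (onC 3F))) (∈∖N[]⁺ (inS 4F) ¬xv₄ (proj₂ (onC 4F)))
      (proj₁ lows) (proj₂ lows)
    where
    inS : AllVertices (_∈ S) C
    inS = proj₁ ∘ onC
    ¬xv₁ : ¬ Adj G x (vertex C 1F)
    ¬xv₁ xv₁ = no-triangle girth xv₀ (edge C 0F) (adj-sym xv₁)
    ¬xv₄ : ¬ Adj G x (vertex C 4F)
    ¬xv₄ xv₄ = no-triangle girth xv₄ (edge C 4F) (adj-sym xv₀)
    ¬xv₂ : ¬ Adj G x (vertex C 2F)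
    ¬xv₂ xv₂ = no-square girth xv₀ (edge C 0F) (edge C 1F) (adj-sym xv₂)
                 (≢-sym (proj₂ (onC 1F))) (v₀≢v₂ C)
    ¬xv₃ : ¬ Adj G x (vertex C 3F)
    ¬xv₃ xv₃ = no-square girth xv₀ (adj-sym (edge C 4F)) (adj-sym (edge C 3F)) (adj-sym xv₃)
                 (≢-sym (proj₂ (onC 4F))) (≢-sym (v₃≢v₀ C))
    lows : Deg≤2 S (vertex C 1F) × Deg≤2 S (vertex C 4F)
    lows = basicIn-neighbours₀ C basic
      (⊥-elim ∘ ¬deg≤2-v₀ C inS x∈S (adj-sym xv₀) (≢-sym (proj₂ (onC 1F))) (≢-sym (proj₂ (onC 4F))))

  roles-∖N[] : GirthAtLeast5 G → ∀ {S x} → x ∈ S →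
               ∀ C → AllVertices (_∈ S) C → BasicIn S C → AllVertices (HasRole (S ∖N[ x ])) C
  roles-∖N[] girth {S} {x} x∈S C inS basic with any? (λ p → vertex C p ≟ x)
  ... | yes (p , vₚ≡x) =
    wlog-vertex₀ {P = HasRole (S ∖N[ x ])} {R = _≡ x} {T = _∈ S} roles-∖N[]-on C p inS basic vₚ≡x
  ... | no off with any? (λ p → Adj? x (vertex C p))
  ...   | yes (p , xvₚ) =
    wlog-vertex₀ {P = HasRole (S ∖N[ x ])} {R = Adj G x} {T = λ u → u ∈ S × u ≢ x}
      (roles-∖N[]-beside girth x∈S) C p (λ i → inS i , λ vᵢ≡x → off (i , vᵢ≡x)) basic xvₚ
  ...   | no apart =
    roles-intact C (λ i → ∈∖N[]⁺ (inS i) (λ xvᵢ → apart (i , xvᵢ)) (λ vᵢ≡x → off (i , vᵢ≡x)))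
                   (basicIn-mono ∈∖N[]⇒∈ {C} basic)

  locallyPC-∖N[] : GirthAtLeast5 G → ∀ {S x} → x ∈ S → LocallyPC S → LocallyPC (S ∖N[ x ])
  locallyPC-∖N[] girth {S} {x} x∈S pc v v∈ with pc v (∈∖N[]⇒∈ v∈)
  ... | isolated none = isolated (λ w → none w ∘ ∈∖N[]⇒∈)
  ... | leaf u only with u ∈? S ∖N[ x ]
  ...   | yes u∈ = leaf u (onlyNeighbour-mono ∈∖N[]⇒∈ u∈ only)
  ...   | no u∉  = isolated (onlyNeighbour-removed ∈∖N[]⇒∈ u∉ only)
  locallyPC-∖N[] girth {S} {x} x∈S pc v v∈ | support l l∈S only with l ∈? S ∖N[ x ]
  ...   | yes l∈ = support l l∈ (onlyNeighbour-mono ∈∖N[]⇒∈ v∈ only)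
  ...   | no l∉  = ⊥-elim (l∉ (∈∖N[]⁺ l∈S ¬xl l≢x))
    where
    ¬xl : ¬ Adj G x l
    ¬xl xl = ∈∖N[]⇒≢ v∈ (≡.sym (proj₂ (proj₂ only) x x∈S (adj-sym xl)))
    l≢x : l ≢ x
    l≢x refl = ∈∖N[]⇒¬adj v∈ (proj₁ (proj₂ only))
  locallyPC-∖N[] girth {S} {x} x∈S pc v v∈ | onBasic C i vᵢ≡v inS basic =
    subst (HasRole (S ∖N[ x ])) vᵢ≡v (roles-∖N[] girth x∈S C inS basic i) v∈

  -- Woodroofe's criterion for x to be a shedding vertex of G[S].
  SheddingVertex : Subset n → Fin n → Set
  SheddingVertex S x = ∀ J → Independent G (S ∖N[ x ]) J →
                       Σ (Fin n) λ y → y ∈ S × Adj G x y × (∀ u → u ∈ J → ¬ Adj G u y)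

  maximal-∖N[]⇒maximal-∪⁅x⁆ : ∀ {S x I} → x ∈ S → MaximalIndependent G (S ∖N[ x ]) I →
                              MaximalIndependent G S (I ∪ ⁅ x ⁆)
  maximal-∖N[]⇒maximal-∪⁅x⁆ {S} {x} {I} x∈S ((I⊆ , independent) , maximal) =
    (⊆S , independent′) , maximal′
    where
    split : ∀ {u} → u ∈ I ∪ ⁅ x ⁆ → u ∈ I ⊎ u ≡ x
    split u∈ = Sum.map₂ (x∈⁅y⁆⇒x≡y x) (x∈p∪q⁻ I ⁅ x ⁆ u∈)
    x∈I∪⁅x⁆ : x ∈ I ∪ ⁅ x ⁆
    x∈I∪⁅x⁆ = x∈p∪q⁺ (inj₂ (x∈⁅x⁆ x))
    ⊆S : I ∪ ⁅ x ⁆ ⊆ S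
    ⊆S u∈ with split u∈
    ... | inj₁ u∈I = ∈∖N[]⇒∈ (I⊆ u∈I)
    ... | inj₂ refl = x∈S
    independent′ : ∀ u v → u ∈ I ∪ ⁅ x ⁆ → v ∈ I ∪ ⁅ x ⁆ → ¬ Adj G u v
    independent′ u v u∈ v∈ with split u∈ | split v∈
    ... | inj₁ u∈I | inj₁ v∈I = independent u v u∈I v∈I
    ... | inj₁ u∈I | inj₂ refl = ∈∖N[]⇒¬adj (I⊆ u∈I) ∘ adj-sym
    ... | inj₂ refl | inj₁ v∈I = ∈∖N[]⇒¬adj (I⊆ v∈I)
    ... | inj₂ refl | inj₂ refl = ¬adj-refl x
    maximal′ : ∀ v → v ∈ S → v ∉ I ∪ ⁅ x ⁆ → Σ (Fin n) λ u → u ∈ I ∪ ⁅ x ⁆ × Adj G u v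
    maximal′ v v∈S v∉ with Adj? x v
    ... | yes xv = x , x∈I∪⁅x⁆ , xv
    ... | no ¬xv with maximal v (∈∖N[]⁺ v∈S ¬xv λ { refl → v∉ x∈I∪⁅x⁆ }) (v∉ ∘ x∈p∪q⁺ ∘ inj₁)
    ...   | u , u∈I , uv = u , x∈p∪q⁺ (inj₁ u∈I) , uv

  wellCovered-∖N[] : ∀ {S x} → x ∈ S → WellCovered G S → WellCovered G (S ∖N[ x ])
  wellCovered-∖N[] {S} {x} x∈S wc I J mI mJ = suc-injective (begin
    suc ∣ I ∣       ≡⟨ ≡.sym (∣p∪⁅x⁆∣≡1+∣p∣ I (x∉ mI)) ⟩
    ∣ I ∪ ⁅ x ⁆ ∣   ≡⟨ wc _ _ (maximal-∖N[]⇒maximal-∪⁅x⁆ x∈S mI) (maximal-∖N[]⇒maximal-∪⁅x⁆ x∈S mJ) ⟩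
    ∣ J ∪ ⁅ x ⁆ ∣   ≡⟨ ∣p∪⁅x⁆∣≡1+∣p∣ J (x∉ mJ) ⟩
    suc ∣ J ∣       ∎)
    where
    x∉ : ∀ {K} → MaximalIndependent G (S ∖N[ x ]) K → x ∉ K
    x∉ ((K⊆ , _) , _) x∈K = ∈∖N[]⇒≢ (K⊆ x∈K) refl

  undominated⇒⊆∖N[] : ∀ {S x I} → I ⊆ S - x → ¬ (∃ λ u → u ∈ I × Adj G u x) → I ⊆ S ∖N[ x ]
  undominated⇒⊆∖N[] {S} I⊆ undominated {u} u∈I =
    ∈∖N[]⁺ (x∈p-y⇒x∈p S (I⊆ u∈I)) (λ xu → undominated (u , u∈I , adj-sym xu)) (x∈p-y⇒x≢y S (I⊆ u∈I))

  maximal-minus⇒maximal : ∀ {S x I} → SheddingVertex S x → MaximalIndependent G (S - x) I →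
                          MaximalIndependent G S I
  maximal-minus⇒maximal {S} {x} {I} shed ((I⊆ , independent) , maximal) =
    (x∈p-y⇒x∈p S ∘ I⊆ , independent) , maximal′
    where
    maximal′ : ∀ v → v ∈ S → v ∉ I → Σ (Fin n) λ u → u ∈ I × Adj G u v
    maximal′ v v∈S v∉I with v ≟ x
    ... | no v≢x = maximal v (x∈p∧x≢y⇒x∈p-y v∈S v≢x) v∉I
    ... | yes refl with any? (λ u → u ∈? I ×-dec Adj? u x)
    ...   | yes dominated = dominated
    ...   | no undominated with shed I (undominated⇒⊆∖N[] I⊆ undominated , independent)
    ...     | y , y∈S , xy , y-free
      with maximal y (x∈p∧x≢y⇒x∈p-y y∈S (≢-sym (adj⇒≢ xy))) (λ y∈I → undominated (y , y∈I , adj-sym xy))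
    ...     | u , u∈I , uy = ⊥-elim (y-free u u∈I uy)

  wellCovered-minus : ∀ {S x} → SheddingVertex S x → WellCovered G S → WellCovered G (S - x)
  wellCovered-minus shed wc I J mI mJ =
    wc I J (maximal-minus⇒maximal shed mI) (maximal-minus⇒maximal shed mJ)

  record Shedder (S : Subset n) (x : Fin n) : Set where
    field
      minus-locallyPC   : LocallyPC (S - x)
      minus-wellCovered : WellCovered G (S - x)
      link-locallyPC    : LocallyPC (S ∖N[ x ])
      link-wellCovered  : WellCovered G (S ∖N[ x ])
  open Shedder public

  shedder : GirthAtLeast5 G → ∀ {S x} → LocallyPC S → WellCovered G S → x ∈ S →
            CycleNeighboursDeg≤2 S x → LeafOnlyInK₂ S x → SheddingVertex S x → Shedder S x
  shedder girth pc wc x∈S around k₂ shed = record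
    { minus-locallyPC   = locallyPC-minus pc around k₂
    ; minus-wellCovered = wellCovered-minus shed wc
    ; link-locallyPC    = locallyPC-∖N[] girth x∈S pc
    ; link-wellCovered  = wellCovered-∖N[] x∈S wc
    }

  support-shedder : GirthAtLeast5 G → ∀ {S x l} → LocallyPC S → WellCovered G S →
                    x ∈ S → l ∈ S → OnlyNeighbour S l x → Shedder S x
  support-shedder girth {S} {x} {l} pc wc x∈S l∈S (_ , lx , onlyX) =
    shedder girth pc wc x∈S around k₂ shed
    where
    around : CycleNeighboursDeg≤2 S x
    around C inS basic v₀≡x = basicIn-neighbours₀ C basic
      (⊥-elim ∘ ¬deg≤2-v₀ C inS l∈S v₀l l≢v₁ l≢v₄)
      where
      v₀l : Adj G (vertex C 0F) l
      v₀l = subst (λ v → Adj G v l) (≡.sym v₀≡x) (adj-sym lx)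
      l≢v₁ : l ≢ vertex C 1F
      l≢v₁ refl = v₀≢v₂ C (trans v₀≡x (≡.sym (onlyX _ (inS 2F) (edge C 1F))))
      l≢v₄ : l ≢ vertex C 4F
      l≢v₄ refl = v₃≢v₀ C (trans (onlyX _ (inS 3F) (adj-sym (edge C 3F))) (≡.sym v₀≡x))
    k₂ : LeafOnlyInK₂ S x
    k₂ v (_ , _ , onlyV) with onlyV l l∈S (adj-sym lx)
    ... | refl = x∈S , lx , onlyX
    shed : SheddingVertex S x
    shed J (J⊆ , _) = l , l∈S , adj-sym lx ,
      λ u u∈J ul → ∈∖N[]⇒≢ (J⊆ u∈J) (onlyX u (∈∖N[]⇒∈ (J⊆ u∈J)) (adj-sym ul))

  pentagon-shedder : GirthAtLeast5 G → ∀ {S} → LocallyPC S → WellCovered G S →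
                     ∀ C → AllVertices (_∈ S) C → Deg≤2 S (vertex C 1F) → Deg≤2 S (vertex C 4F) →
                     Shedder S (vertex C 0F)
  pentagon-shedder girth {S} pc wc C inS low₁ low₄ = shedder girth pc wc (inS 0F) around k₂ shed
    where
    x : Fin n
    x = vertex C 0F
    neighbours-deg≤2 : Deg≤2 S x → ∀ w → w ∈ S → Adj G x w → Deg≤2 S w
    neighbours-deg≤2 low₀ w w∈S xw
      with low₀ (inS 1F) (inS 4F) (edge C 0F) (adj-sym (edge C 4F)) (v₁≢v₄ C) w w∈S xw
    ... | inj₁ refl = low₁
    ... | inj₂ refl = low₄
    around : CycleNeighboursDeg≤2 S x
    around C′ inS′ basic′ v₀′≡x = basicIn-neighbours₀ C′ basic′ λ low₀′ →
      let low₀ = subst (Deg≤2 S) v₀′≡x low₀′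
      in neighbours-deg≤2 low₀ _ (inS′ 1F) (subst (λ v → Adj G v _) v₀′≡x (edge C′ 0F)) ,
         neighbours-deg≤2 low₀ _ (inS′ 4F) (subst (λ v → Adj G v _) v₀′≡x (adj-sym (edge C′ 4F)))
    k₂ : LeafOnlyInK₂ S x
    k₂ v (_ , _ , only) =
      ⊥-elim (v₁≢v₄ C (trans (only _ (inS 1F) (edge C 0F)) (≡.sym (only _ (inS 4F) (adj-sym (edge C 4F))))))
    -- If v₃ ∈ J then v₁ (whose other neighbour v₂ touches v₃) extends J; otherwise v₄ does.
    shed : SheddingVertex S x
    shed J (J⊆ , independent) with vertex C 3F ∈? J
    ... | yes v₃∈J = vertex C 1F , inS 1F , edge C 0F , λ u u∈J uv₁ →
      [ ∈∖N[]⇒≢ (J⊆ u∈J) , (λ { refl → independent _ _ u∈J v₃∈J (edge C 2F) }) ]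
        (low₁ (inS 0F) (inS 2F) (adj-sym (edge C 0F)) (edge C 1F) (v₀≢v₂ C)
              u (∈∖N[]⇒∈ (J⊆ u∈J)) (adj-sym uv₁))
    ... | no v₃∉J = vertex C 4F , inS 4F , adj-sym (edge C 4F) , λ u u∈J uv₄ →
      [ (λ { refl → v₃∉J u∈J }) , ∈∖N[]⇒≢ (J⊆ u∈J) ]
        (low₄ (inS 3F) (inS 0F) (adj-sym (edge C 3F)) (edge C 4F) (v₃≢v₀ C)
              u (∈∖N[]⇒∈ (J⊆ u∈J)) (adj-sym uv₄))

  shedder-exists : GirthAtLeast5 G → ∀ {S u w} → LocallyPC S → WellCovered G S →
                   u ∈ S → w ∈ S → Adj G u w → Σ (Fin n) λ x → x ∈ S × Shedder S x
  shedder-exists girth {S} pc wc u∈S w∈S uw with pc _ u∈S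
  ... | isolated none = ⊥-elim (none _ w∈S uw)
  ... | leaf p onlyP = p , proj₁ onlyP , support-shedder girth pc wc (proj₁ onlyP) u∈S onlyP
  ... | support l l∈S onlyU = _ , u∈S , support-shedder girth pc wc u∈S l∈S onlyU
  ... | onBasic C _ _ inS basic with basicIn⇒sheddable-position C basic
  ...   | p , low₁ , low₄ =
    vertex (rotateTo p C) 0F , inS′ 0F , pentagon-shedder girth pc wc (rotateTo p C) inS′ low₁ low₄
    where
    inS′ : AllVertices (_∈ S) (rotateTo p C)
    inS′ = allVertices-rotateBy⁺ {_∈ S} (toℕ p) C inS

  edge? : ∀ S → Dec (∃ λ u → u ∈ S × ∃ λ w → w ∈ S × Adj G u w)
  edge? S = any? λ u → u ∈? S ×-dec any? λ w → w ∈? S ×-dec Adj? u w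

  locallyPC⇒vertexDecomposable : GirthAtLeast5 G → ∀ {S} → LocallyPC S → WellCovered G S →
                                 VertexDecomposable G S
  locallyPC⇒vertexDecomposable girth {S} = go (On.wellFounded ∣_∣ <-wellFounded S)
    where
    go : ∀ {S} → Acc (_<_ on ∣_∣) S → LocallyPC S → WellCovered G S → VertexDecomposable G S
    go {S} (acc smaller) pc wc with edge? S
    ... | no edgeless = vd-empty wc λ u w u∈S w∈S uw → edgeless (u , u∈S , w , w∈S , uw)
    ... | yes (u , u∈S , w , w∈S , uw) with shedder-exists girth pc wc u∈S w∈S uw
    ...   | x , x∈S , sh =
      vd-shed wc x x∈S (go (smaller (x∈p⇒∣p-x∣<∣p∣ x∈S)) (minus-locallyPC sh) (minus-wellCovered sh))
                       (go (smaller (∣∖N[]∣<∣p∣ x∈S)) (link-locallyPC sh) (link-wellCovered sh))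

  inducedCycle⇒pentagon : ∀ {B} → IsInducedCycle G 5 B → Pentagon
  inducedCycle⇒pentagon {B} (_ , _ , adj⇔cyc) = record
    { vertex    = B
    ; edge      = λ i → Equivalence.from (adj⇔cyc i (next i)) (cycAdj-next i)
    ; chordless = λ i → ¬cycAdj-next² i ∘ Equivalence.to (adj⇔cyc i (next (next i)))
    }
    where
    cycAdj-next : ∀ i → CycAdj 5 i (next i)
    cycAdj-next 0F = inj₁ refl
    cycAdj-next 1F = inj₁ refl
    cycAdj-next 2F = inj₁ refl
    cycAdj-next 3F = inj₁ refl
    cycAdj-next 4F = inj₂ (inj₂ (inj₁ (refl , refl)))
    ¬cycAdj-next² : ∀ i → ¬ CycAdj 5 i (next (next i))
    ¬cycAdj-next² 0F = from-no (cycAdj? 5 0F 2F)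
    ¬cycAdj-next² 1F = from-no (cycAdj? 5 1F 3F)
    ¬cycAdj-next² 2F = from-no (cycAdj? 5 2F 4F)
    ¬cycAdj-next² 3F = from-no (cycAdj? 5 3F 0F)
    ¬cycAdj-next² 4F = from-no (cycAdj? 5 4F 1F)

  basic5Cycle⇒basicIn : ∀ {B} (basic : Basic5Cycle G B) → BasicIn ⊤ (inducedCycle⇒pentagon (proj₁ basic))
  basic5Cycle⇒basicIn (cycle , lowEnd) i =
    Sum.map deg<3⇒deg≤2 deg<3⇒deg≤2 (lowEnd i (next i) (edge (inducedCycle⇒pentagon cycle) i))

  inPC⇒locallyPC : InPC G → LocallyPC ⊤
  inPC⇒locallyPC (P , _ , _ , basic , _ , _ , covered , _ , matched) v _ with v ∈? P
  ... | yes v∈P with matched v v∈P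
  ...   | u , (vu , inj₁ deg-v≡1) , _ = leaf u (deg≡1⇒onlyNeighbour deg-v≡1 vu)
  ...   | u , (vu , inj₂ deg-u≡1) , _ = support u ∈⊤ (deg≡1⇒onlyNeighbour deg-u≡1 (adj-sym vu))
  inPC⇒locallyPC (P , _ , _ , basic , _ , _ , covered , _ , matched) v _ | no v∉P
    with covered v v∉P
  ... | a , i , cycₐᵢ≡v =
    onBasic (inducedCycle⇒pentagon (proj₁ (basic a))) i cycₐᵢ≡v (λ _ → ∈⊤) (basic5Cycle⇒basicIn (basic a))

lemma5p2 : {n : ℕ} (G : Graph n) → WellCovered G ⊤ → GirthAtLeast5 G → InPC G →
    (B : Fin 5 → Fin n) → Basic5Cycle G B →
    (i j k : Fin 5) → j ≢ k → Adj G (B i) (B j) → Adj G (B i) (B k) →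
    deg G (B j) ≡ 2 → deg G (B k) ≡ 2 →
    Shed G ⊤ (B i)
lemma5p2 {n} G wc girth pc B basic i j k j≢k BᵢBⱼ BᵢBₖ deg-j deg-k =
  locallyPC⇒vertexDecomposable girth (minus-locallyPC sh) (minus-wellCovered sh) ,
  locallyPC⇒vertexDecomposable girth (link-locallyPC sh) (link-wellCovered sh)
  where
  open Shedding G
  pentagon : Pentagon
  pentagon = inducedCycle⇒pentagon (proj₁ basic)
  C : Pentagon
  C = rotateTo i pentagon
  v₀≡Bᵢ : vertex C 0F ≡ B i
  v₀≡Bᵢ = vertex-rotateTo i pentagon
  OnSide : Fin n → Set
  OnSide u = Adj G (vertex C 0F) u → u ≡ vertex C 1F ⊎ u ≡ vertex C 4F
  side : ∀ {m} → Adj G (B i) (B m) → B m ≡ vertex C 1F ⊎ B m ≡ vertex C 4F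
  side {m} BᵢBₘ = allVertices-rotateBy⁻ {OnSide} (toℕ i) pentagon (neighbours-of-v₀ C) m
                    (subst (λ v → Adj G v (B m)) (≡.sym v₀≡Bᵢ) BᵢBₘ)
  deg≤2 : ∀ {m} → deg G (B m) ≡ 2 → Deg≤2 ⊤ (B m)
  deg≤2 deg≡2 = deg<3⇒deg≤2 (subst (_< 3) (≡.sym deg≡2) (n<1+n 2))
  lows : Deg≤2 ⊤ (vertex C 1F) × Deg≤2 ⊤ (vertex C 4F)
  lows = cover-pair {Q = Deg≤2 ⊤} (side BᵢBⱼ) (side BᵢBₖ) (j≢k ∘ proj₁ (proj₂ (proj₁ basic)) j k)
                    (deg≤2 deg-j) (deg≤2 deg-k)
  sh : Shedder ⊤ (B i)
  sh = subst (Shedder ⊤) v₀≡Bᵢ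
         (pentagon-shedder girth (inPC⇒locallyPC pc) wc C (λ _ → ∈⊤) (proj₁ lows) (proj₂ lows))
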